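{- Let $A\subseteq\{2,3,\dots\}$ and let $G\in\mathcal{G}(A)$. Let $x_0$ be a vertex of $G$ having two distinct neighbours $x_0^+,x_0^-$ with $N(x_0^+)=N(x_0^-)=\{x_0\}$, and let $V(G)=\bigcup_{i=0}^N L_i$ be the levelling of $G$ from $x_0$. Let $i>1$. If there is a vertex $u\in L_{i-1}$ such that $N(u)\cap L_i$ is not a clique, then $i\in A$.
   Context: All graphs are finite and simple. For $i\ge2$, $P_i$ is the path on $i$ vertices and the bone $B_i$ is the tree obtained from $P_i$ by attaching two pendent edges (edges to new degree-one vertices) to each of its two end vertices. $\mathcal{G}(A)$ is the family of connected graphs $G$ such that every induced subgraph of $G$ isomorphic to a bone $B_i$ has $i\in A$. For a connected graph $G$ and vertex $x_0$, the levelling of $G$ from $x_0$ is the partition $V(G)=\bigcup_{i=0}^N L_i$, $L_i=\{u:\operatorname{dist}(u,x_0)=i\}$, $N$ the largest index with $L_N\ne\emptyset$. (In the paper, $L_i$ is called clean if $N(u)\cap L_i$ is a clique for every $u\in L_{i-1}$; the lemma says a non-clean level $L_i$ with $i>1$ forces $i\in A$.) -}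

module Defs where

open import Data.Nat using (ℕ; zero; suc; _<_; _≤_)
open import Data.Fin using (Fin; toℕ)
open import Data.Empty using (⊥)
open import Data.Bool using (Bool; true; false)
open import Data.Sum using (_⊎_; inj₁; inj₂)
open import Data.Product using (Σ; _×_; _,_)
open import Relation.Binary.PropositionalEquality using (_≡_; _≢_)
open import Relation.Nullary using (¬_)
open import Function.Bundles using (_⇔_)

record Graph : Set where
  field
    n      : ℕ
    adj    : Fin n → Fin n → Bool
    sym    : ∀ u v → adj u v ≡ adj v u
    irrefl : ∀ u → adj u u ≡ false

open Graph public

Adj : (G : Graph) → Fin (n G) → Fin (n G) → Set
Adj G u v = adj G u v ≡ true

data Walk (G : Graph) : Fin (n G) → Fin (n G) → ℕ → Set where
  here : ∀ {u} → Walk G u u zero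
  step : ∀ {u w v k} → Adj G u w → Walk G w v k → Walk G u v (suc k)

Dist : (G : Graph) → Fin (n G) → Fin (n G) → ℕ → Set
Dist G u v d = Walk G u v d × (∀ k → k < d → ¬ Walk G u v k)

Connected : Graph → Set
Connected G = ∀ u v → Σ ℕ (λ k → Walk G u v k)

Level : (G : Graph) → Fin (n G) → ℕ → Fin (n G) → Set
Level G x0 i u = Dist G x0 u i

-- The bone B_i: path vertices p_0..p_{i-1} (inj₁), and leaves inj₂ c, c ∈ Fin 4,
-- where leaves 0,1 hang at p_0 and leaves 2,3 hang at p_{i-1}.
BoneV : ℕ → Set
BoneV i = Fin i ⊎ Fin 4

PathLeafAdj : (i : ℕ) → Fin i → Fin 4 → Set
PathLeafAdj i j c = (toℕ c < 2 × toℕ j ≡ 0) ⊎ (2 ≤ toℕ c × suc (toℕ j) ≡ i)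

BoneAdj : (i : ℕ) → BoneV i → BoneV i → Set
BoneAdj i (inj₁ j) (inj₁ k) = (toℕ k ≡ suc (toℕ j)) ⊎ (toℕ j ≡ suc (toℕ k))
BoneAdj i (inj₁ j) (inj₂ c) = PathLeafAdj i j c
BoneAdj i (inj₂ c) (inj₁ j) = PathLeafAdj i j c
BoneAdj i (inj₂ c) (inj₂ d) = ⊥

InducedBone : (G : Graph) → ℕ → Set
InducedBone G i = Σ (BoneV i → Fin (n G)) λ f →
  (∀ a b → f a ≡ f b → a ≡ b) ×
  (∀ a b → Adj G (f a) (f b) ⇔ BoneAdj i a b)

InFamily : (ℕ → Set) → Graph → Set
InFamily A G = Connected G × (∀ i → 2 ≤ i → InducedBone G i → A i)

{-# OPTIONS --safe #-}
module Submission where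

-- Let x0 = p_0, p_1, …, p_{i-1} = u be a shortest path. Being geodesic it is
-- induced, and p_j ∈ L_j. Attach x0⁺, x0⁻ at p_0 and the two non-adjacent
-- vertices v, w ∈ N(u) ∩ L_i at p_{i-1}: this is an induced B_i, because x0⁺
-- and x0⁻ see only x0, while v and w see no p_j with j < i - 1, as the levels
-- of adjacent vertices differ by at most one.

open import Defs hiding (sym)
open import Data.Nat using (ℕ; zero; suc; _+_; _∸_; _<_; _≤_; z≤n; s≤s; _≤?_)
open import Data.Nat.Properties
  using (<-cmp; ≤-antisym; ≤-pred; ≰⇒>; <⇒≢; <⇒≱; m≤n⇒m<n∨m≡n; m+[n∸m]≡n; +-monoˡ-<; suc-injective)
open import Data.Fin using (Fin; toℕ; splitAt; join)
open import Data.Fin.Patterns using (0F; 1F; 2F; 3F)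
open import Data.Fin.Properties using (toℕ-injective; toℕ<n; toℕ≤pred[n]; join-splitAt)
open import Data.Vec.Functional using ([]; _∷_)
open import Data.Product using (Σ; ∃; _×_; _,_; proj₁)
open import Data.Sum using (_⊎_; inj₁; inj₂; [_,_])
open import Data.Empty using (⊥-elim)
open import Relation.Binary using (tri<; tri≈; tri>)
open import Relation.Binary.PropositionalEquality
  using (_≡_; _≢_; refl; sym; trans; cong; subst; module ≡-Reasoning)
open import Relation.Nullary using (¬_; yes; no)
open import Function using (_∘_)
open import Function.Bundles using (_⇔_; mk⇔; Equivalence)
open import Function.Definitions using (Injective)
open import Function.Properties.Equivalence using () renaming (sym to ⇔-sym; trans to ⇔-trans)

open Equivalence using (to; from)

within-one-≢⇒successor : ∀ {j l} → j ≤ suc l → l ≤ suc j → j ≢ l → l ≡ suc j ⊎ j ≡ suc l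
within-one-≢⇒successor {j} {l} j≤1+l l≤1+j j≢l with <-cmp j l
... | tri< j<l _ _ = inj₁ (≤-antisym l≤1+j j<l)
... | tri≈ _ j≡l _ = ⊥-elim (j≢l j≡l)
... | tri> _ _ l<j = inj₂ (≤-antisym j≤1+l l<j)

[,]-injective : ∀ {A B C : Set} {f : A → C} {g : B → C} →
  Injective _≡_ _≡_ f → Injective _≡_ _≡_ g → (∀ a b → f a ≢ g b) →
  Injective _≡_ _≡_ [ f , g ]
[,]-injective f-inj g-inj f≢g {inj₁ a} {inj₁ a′} eq = cong inj₁ (f-inj eq)
[,]-injective f-inj g-inj f≢g {inj₁ a} {inj₂ b}  eq = ⊥-elim (f≢g a b eq)
[,]-injective f-inj g-inj f≢g {inj₂ b} {inj₁ a}  eq = ⊥-elim (f≢g a b (sym eq))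
[,]-injective f-inj g-inj f≢g {inj₂ b} {inj₂ b′} eq = cong inj₂ (g-inj eq)

pair-injective : ∀ {A : Set} {x y : A} → x ≢ y → Injective _≡_ _≡_ (x ∷ y ∷ [])
pair-injective x≢y {0F} {0F} _  = refl
pair-injective x≢y {0F} {1F} eq = ⊥-elim (x≢y eq)
pair-injective x≢y {1F} {0F} eq = ⊥-elim (x≢y (sym eq))
pair-injective x≢y {1F} {1F} _  = refl

PathLeafAdj-start : ∀ {i j c} → toℕ c < 2 → PathLeafAdj i j c ⇔ (toℕ j ≡ 0)
PathLeafAdj-start c<2 = mk⇔ (λ { (inj₁ (_ , j≡0)) → j≡0 ; (inj₂ (2≤c , _)) → ⊥-elim (<⇒≱ c<2 2≤c) })
                            (λ j≡0 → inj₁ (c<2 , j≡0))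

PathLeafAdj-end : ∀ {i j c} → 2 ≤ toℕ c → PathLeafAdj i j c ⇔ (suc (toℕ j) ≡ i)
PathLeafAdj-end 2≤c = mk⇔ (λ { (inj₁ (c<2 , _)) → ⊥-elim (<⇒≱ c<2 2≤c) ; (inj₂ (_ , j≡i)) → j≡i })
                          (λ j≡i → inj₂ (2≤c , j≡i))

Pendant : (G : Graph) → Fin (n G) → Fin (n G) → Set
Pendant G x ℓ = ∀ y → Adj G ℓ y ⇔ (y ≡ x)

module GraphProperties (G : Graph) where

  Adj-irrefl : ∀ {a} → ¬ Adj G a a
  Adj-irrefl {a} a∼a with trans (sym a∼a) (irrefl G a)
  ... | ()

  Adj-sym : ∀ {a b} → Adj G a b → Adj G b a
  Adj-sym {a} {b} = trans (Graph.sym G b a)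

  Adj-sym⇔ : ∀ {a b} → Adj G a b ⇔ Adj G b a
  Adj-sym⇔ = mk⇔ Adj-sym Adj-sym

  _∷ʳ_ : ∀ {a b c k} → Walk G a b k → Adj G b c → Walk G a c (suc k)
  here       ∷ʳ e = step e here
  step e′ W ∷ʳ e = step e′ (W ∷ʳ e)

  _++_ : ∀ {a b c k m} → Walk G a b k → Walk G b c m → Walk G a c (k + m)
  here     ++ W′ = W′
  step e W ++ W′ = step e (W ++ W′)

  -- Past the end of the walk this stays at its last vertex.
  vertex : ∀ {a b k} → Walk G a b k → ℕ → Fin (n G)
  vertex {a} W          zero    = a
  vertex {a} here       (suc j) = a
  vertex     (step _ W) (suc j) = vertex W j

  vertex-last : ∀ {a b k} (W : Walk G a b k) → vertex W k ≡ b
  vertex-last here       = refl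
  vertex-last (step _ W) = vertex-last W

  vertex-adj : ∀ {a b k} (W : Walk G a b k) {j} → j < k → Adj G (vertex W j) (vertex W (suc j))
  vertex-adj (step e W) {zero}  _         = e
  vertex-adj (step e W) {suc j} (s≤s j<k) = vertex-adj W j<k

  take : ∀ {a b k} (W : Walk G a b k) {j} → j ≤ k → Walk G a (vertex W j) j
  take W          {zero}  _         = here
  take (step e W) {suc j} (s≤s j≤k) = step e (take W j≤k)

  drop : ∀ {a b k} (W : Walk G a b k) {j} → j ≤ k → Walk G (vertex W j) b (k ∸ j)
  drop W          {zero}  _         = W
  drop (step e W) {suc j} (s≤s j≤k) = drop W j≤k

  Dist-zero : ∀ {a} → Dist G a a 0
  Dist-zero = here , λ _ ()

  Dist-unique : ∀ {a b d e} → Dist G a b d → Dist G a b e → d ≡ e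
  Dist-unique {d = d} {e} (W , d-min) (W′ , e-min) with <-cmp d e
  ... | tri< d<e _ _ = ⊥-elim (e-min d d<e W)
  ... | tri≈ _ d≡e _ = d≡e
  ... | tri> _ _ e<d = ⊥-elim (d-min e e<d W′)

  Dist-≡ : ∀ {a b c d e} → Dist G a b d → Dist G a c e → b ≡ c → d ≡ e
  Dist-≡ Db Dc refl = Dist-unique Db Dc

  Dist-≢ : ∀ {a b c d e} → Dist G a b d → Dist G a c e → d ≢ e → b ≢ c
  Dist-≢ Db Dc d≢e = d≢e ∘ Dist-≡ Db Dc

  Dist-suc-≢ : ∀ {a b j} → Dist G a b (suc j) → b ≢ a
  Dist-suc-≢ D = Dist-≢ D Dist-zero (λ ())

  Dist-adj-≤ : ∀ {a b c j l} → Dist G a b j → Adj G b c → Dist G a c l → l ≤ suc j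
  Dist-adj-≤ {j = j} {l} (W , _) b∼c (_ , l-min) with l ≤? suc j
  ... | yes l≤1+j = l≤1+j
  ... | no  l≰1+j = ⊥-elim (l-min (suc j) (≰⇒> l≰1+j) (W ∷ʳ b∼c))

  -- A shorter walk to the j-th vertex, followed by the rest of W, would beat W.
  Dist-take : ∀ {a b k} (D : Dist G a b k) {j} → j ≤ k → Dist G a (vertex (proj₁ D) j) j
  Dist-take {k = k} (W , k-min) {j} j≤k = take W j≤k , λ m m<j W′ →
    k-min (m + (k ∸ j)) (subst (m + (k ∸ j) <_) (m+[n∸m]≡n j≤k) (+-monoˡ-< (k ∸ j) m<j))
          (W′ ++ drop W j≤k)

  geodesic-adj⇔ : ∀ {a b k} (D : Dist G a b k) {j l} → j ≤ k → l ≤ k →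
    Adj G (vertex (proj₁ D) j) (vertex (proj₁ D) l) ⇔ (l ≡ suc j ⊎ j ≡ suc l)
  geodesic-adj⇔ D@(W , _) j≤k l≤k = mk⇔ consecutive adjacent
    where
    Dj = Dist-take D j≤k
    Dl = Dist-take D l≤k
    consecutive = λ e → within-one-≢⇒successor
      (Dist-adj-≤ Dl (Adj-sym e) Dj) (Dist-adj-≤ Dj e Dl) (λ { refl → Adj-irrefl e })
    adjacent = λ { (inj₁ refl) → vertex-adj W l≤k ; (inj₂ refl) → Adj-sym (vertex-adj W j≤k) }

  pendant-≢ : ∀ {x ℓ} → Pendant G x ℓ → ℓ ≢ x
  pendant-≢ pend refl = Adj-irrefl (from (pend _) refl)

  pendant-Dist : ∀ {x ℓ} → Pendant G x ℓ → Dist G x ℓ 1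
  pendant-Dist {x} pend = step (Adj-sym (from (pend x) refl)) here ,
    λ { zero _ here → pendant-≢ pend refl ; (suc _) (s≤s ()) _ }

  pendant-adj⇔ : ∀ {x ℓ y j} → Pendant G x ℓ → Dist G x y j → Adj G y ℓ ⇔ (j ≡ 0)
  pendant-adj⇔ {x} {ℓ} {y} {j} pend D = mk⇔ at-root (from-root D)
    where
    at-root : Adj G y ℓ → j ≡ 0
    at-root y∼ℓ = Dist-≡ D Dist-zero (to (pend y) (Adj-sym y∼ℓ))
    from-root : ∀ {y′ j′} → Dist G x y′ j′ → j′ ≡ 0 → Adj G y′ ℓ
    from-root (here , _) refl = Adj-sym (from (pend x) refl)

module _ {G : Graph} {x0 u : Fin (n G)} {k : ℕ} (geodesic : Dist G x0 u k) (0<k : 0 < k)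
  {xp xm : Fin (n G)} (xp≢xm : xp ≢ xm) (xp-pendant : Pendant G x0 xp) (xm-pendant : Pendant G x0 xm)
  {v w : Fin (n G)} (v≢w : v ≢ w) (v≁w : ¬ Adj G v w) (u∼v : Adj G u v) (u∼w : Adj G u w)
  (v-Dist : Dist G x0 v (suc k)) (w-Dist : Dist G x0 w (suc k))
  where

  open GraphProperties G

  private
    W = proj₁ geodesic

  path : Fin (suc k) → Fin (n G)
  path j = vertex W (toℕ j)

  path-Dist : ∀ j → Dist G x0 (path j) (toℕ j)
  path-Dist j = Dist-take geodesic (toℕ≤pred[n] j)

  path-last : ∀ {j} → toℕ j ≡ k → path j ≡ u
  path-last j≡k = trans (cong (vertex W) j≡k) (vertex-last W)

  path-injective : Injective _≡_ _≡_ path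
  path-injective {j} {l} eq = toℕ-injective (Dist-≡ (path-Dist j) (path-Dist l) eq)

  path-adj⇔ : ∀ j l → Adj G (path j) (path l) ⇔ BoneAdj (suc k) (inj₁ j) (inj₁ l)
  path-adj⇔ j l = geodesic-adj⇔ geodesic (toℕ≤pred[n] j) (toℕ≤pred[n] l)

  next-level-neighbour : ∀ {j} → j ≤ k → ∃ λ y → Adj G (vertex W j) y × Dist G x0 y (suc j)
  next-level-neighbour j≤k with m≤n⇒m<n∨m≡n j≤k
  ... | inj₁ j<k  = _ , vertex-adj W j<k , Dist-take geodesic j<k
  ... | inj₂ refl = v , subst (λ z → Adj G z v) (sym (vertex-last W)) u∼v , v-Dist

  path≢pendant : ∀ j {ℓ} → Pendant G x0 ℓ → path j ≢ ℓ
  path≢pendant j pend refl with next-level-neighbour (toℕ≤pred[n] j)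
  ... | y , ℓ∼y , y-Dist = Dist-suc-≢ y-Dist (to (pend y) ℓ∼y)

  near far : Fin 2 → Fin (n G)
  near = xp ∷ xm ∷ []
  far  = v ∷ w ∷ []

  near-pendant : ∀ a → Pendant G x0 (near a)
  near-pendant 0F = xp-pendant
  near-pendant 1F = xm-pendant

  far-Dist : ∀ b → Dist G x0 (far b) (suc k)
  far-Dist 0F = v-Dist
  far-Dist 1F = w-Dist

  far-adj : ∀ b → Adj G u (far b)
  far-adj 0F = u∼v
  far-adj 1F = u∼w

  far-independent : ∀ b b′ → ¬ Adj G (far b) (far b′)
  far-independent 0F 0F = Adj-irrefl
  far-independent 0F 1F = v≁w
  far-independent 1F 0F = v≁w ∘ Adj-sym
  far-independent 1F 1F = Adj-irrefl

  path-near-adj⇔ : ∀ j a → Adj G (path j) (near a) ⇔ (toℕ j ≡ 0)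
  path-near-adj⇔ j a = pendant-adj⇔ (near-pendant a) (path-Dist j)

  path-far-adj⇔ : ∀ j b → Adj G (path j) (far b) ⇔ (suc (toℕ j) ≡ suc k)
  path-far-adj⇔ j b = mk⇔
    (λ e → ≤-antisym (toℕ<n j) (Dist-adj-≤ (path-Dist j) e (far-Dist b)))
    (λ j≡k → subst (λ z → Adj G z (far b)) (sym (path-last (suc-injective j≡k))) (far-adj b))

  leaf⊎ : Fin 2 ⊎ Fin 2 → Fin (n G)
  leaf⊎ = [ near , far ]

  leaf⊎-≢-x0 : ∀ s → leaf⊎ s ≢ x0
  leaf⊎-≢-x0 (inj₁ a) = pendant-≢ (near-pendant a)
  leaf⊎-≢-x0 (inj₂ b) = Dist-suc-≢ (far-Dist b)

  leaf⊎-independent : ∀ s t → ¬ Adj G (leaf⊎ s) (leaf⊎ t)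
  leaf⊎-independent (inj₁ a) t        e = leaf⊎-≢-x0 t (to (near-pendant a _) e)
  leaf⊎-independent (inj₂ b) (inj₁ a) e = leaf⊎-≢-x0 (inj₂ b) (to (near-pendant a _) (Adj-sym e))
  leaf⊎-independent (inj₂ b) (inj₂ b′) = far-independent b b′

  leaf⊎-injective : Injective _≡_ _≡_ leaf⊎
  leaf⊎-injective = [,]-injective (pair-injective xp≢xm) (pair-injective v≢w) near≢far
    where
    near≢far : ∀ a b → near a ≢ far b
    near≢far a b = Dist-≢ (pendant-Dist (near-pendant a)) (far-Dist b) (<⇒≢ 0<k ∘ suc-injective)

  path≢leaf⊎ : ∀ j s → path j ≢ leaf⊎ s
  path≢leaf⊎ j (inj₁ a) = path≢pendant j (near-pendant a)
  path≢leaf⊎ j (inj₂ b) = Dist-≢ (path-Dist j) (far-Dist b) (<⇒≢ (toℕ<n j))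

  -- splitAt 2 sends leaves 0, 1 to the pair at x0 and leaves 2, 3 to the pair at u.
  leaf : Fin 4 → Fin (n G)
  leaf = leaf⊎ ∘ splitAt 2

  leaf-injective : Injective _≡_ _≡_ leaf
  leaf-injective {c} {d} eq = begin
    c                      ≡⟨ join-splitAt 2 2 c ⟨
    join 2 2 (splitAt 2 c) ≡⟨ cong (join 2 2) (leaf⊎-injective {splitAt 2 c} {splitAt 2 d} eq) ⟩
    join 2 2 (splitAt 2 d) ≡⟨ join-splitAt 2 2 d ⟩
    d                      ∎
    where open ≡-Reasoning

  path-leaf-adj⇔ : ∀ j c → Adj G (path j) (leaf c) ⇔ PathLeafAdj (suc k) j c
  path-leaf-adj⇔ j 0F = ⇔-trans (path-near-adj⇔ j 0F) (⇔-sym (PathLeafAdj-start (s≤s z≤n)))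
  path-leaf-adj⇔ j 1F = ⇔-trans (path-near-adj⇔ j 1F) (⇔-sym (PathLeafAdj-start (s≤s (s≤s z≤n))))
  path-leaf-adj⇔ j 2F = ⇔-trans (path-far-adj⇔ j 0F) (⇔-sym (PathLeafAdj-end (s≤s (s≤s z≤n))))
  path-leaf-adj⇔ j 3F = ⇔-trans (path-far-adj⇔ j 1F) (⇔-sym (PathLeafAdj-end (s≤s (s≤s z≤n))))

  bone : BoneV (suc k) → Fin (n G)
  bone = [ path , leaf ]

  bone-adj⇔ : ∀ a b → Adj G (bone a) (bone b) ⇔ BoneAdj (suc k) a b
  bone-adj⇔ (inj₁ j) (inj₁ l) = path-adj⇔ j l
  bone-adj⇔ (inj₁ j) (inj₂ c) = path-leaf-adj⇔ j c
  bone-adj⇔ (inj₂ c) (inj₁ j) = ⇔-trans Adj-sym⇔ (path-leaf-adj⇔ j c)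
  bone-adj⇔ (inj₂ c) (inj₂ d) = mk⇔ (leaf⊎-independent (splitAt 2 c) (splitAt 2 d)) λ ()

  induced-bone : InducedBone G (suc k)
  induced-bone = bone , (λ _ _ → bone-injective) , bone-adj⇔
    where
    bone-injective : Injective _≡_ _≡_ bone
    bone-injective = [,]-injective path-injective leaf-injective (λ j → path≢leaf⊎ j ∘ splitAt 2)

lemma2p6 : (A : ℕ → Set) → (∀ a → A a → 2 ≤ a) →
    (G : Graph) → InFamily A G →
    (x0 xp xm : Fin (n G)) → xp ≢ xm →
    (∀ v → Adj G xp v ⇔ (v ≡ x0)) →
    (∀ v → Adj G xm v ⇔ (v ≡ x0)) →
    (i : ℕ) → 1 < i →
    (u : Fin (n G)) → Level G x0 (i ∸ 1) u →
    -- N(u) ∩ L_i is not a clique: two distinct non-adjacent vertices in it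
    Σ (Fin (n G)) (λ v → Σ (Fin (n G)) (λ w →
      Adj G u v × Level G x0 i v × Adj G u w × Level G x0 i w ×
      v ≢ w × ¬ Adj G v w)) →
    A i
lemma2p6 A _ G (_ , bones-in-A) x0 xp xm xp≢xm xp-pendant xm-pendant (suc k) 1<i u geodesic
  (v , w , u∼v , v-Dist , u∼w , w-Dist , v≢w , v≁w) =
  bones-in-A (suc k) 1<i
    (induced-bone geodesic (≤-pred 1<i) xp≢xm xp-pendant xm-pendant v≢w v≁w u∼v u∼w v-Dist w-Dist)
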